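{- Let $E$ be a finite set, $a,b\in E$ distinct, $(\sigma_\circ,\sigma_\bullet)$ any pair in $S_E$, and $(\sigma_\circ^\oplus,\sigma_\bullet^\oplus)$ its reroute relative to $(a,b)$. Let $U$ be the number of $\sigma_\circ\sigma_\bullet$-orbits disjoint from $\{a,\sigma_\circ(a),b\}$, $B$ the number of $\sigma_\circ\sigma_\bullet$-orbits containing at least one of $a,\sigma_\circ(a),b$, and $B^\oplus$ the number of $\sigma_\circ^\oplus\sigma_\bullet^\oplus$-orbits containing at least one of $a_\circ,a_\bullet,b$. Then $z(\sigma_\circ\sigma_\bullet)=U+B$ and $z(\sigma_\circ^\oplus\sigma_\bullet^\oplus)=U+B^\oplus$.
   Context: Permutations compose functionally; $z(\pi)$ is the number of $\pi$-orbits (fixed points included). Reroute relative to $(a,b)$: $E^\oplus=(E\setminus\{a\})\sqcup\{a_\circ,a_\bullet\}$; $\sigma_\circ^\oplus$ is obtained from the disjoint cycle decomposition of $\sigma_\circ$ (fixed points as 1-cycles) by replacing $a$ by $a_\circ$ and inserting $a_\bullet$ immediately before $b$ in the cycle containing $b$; $\sigma_\bullet^\oplus$ is obtained from that of $\sigma_\bullet$ by replacing $a$ by $a_\bullet$ and adjoining the fixed point $a_\circ$. -}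

module Defs where

open import Data.Nat using (ℕ; zero; suc; _+_)
open import Data.Bool using (Bool; true; false; if_then_else_; _∧_; not)
open import Data.Fin using (Fin; zero; suc; _≟_; _<?_)
open import Data.List using (List; []; _∷_; upTo; allFin)
open import Data.Bool.ListAction using (any)
open import Relation.Nullary.Decidable using (⌊_⌋)

_==_ : ∀ {n} → Fin n → Fin n → Bool
x == y = ⌊ x ≟ y ⌋

iter : ∀ {n} → (Fin n → Fin n) → ℕ → Fin n → Fin n
iter π zero    x = x
iter π (suc k) x = π (iter π k x)

-- y lies in the π-orbit of x: y = π^k x for some k.  For a permutation of
-- an n-element set every orbit has at most n elements, so it suffices to
-- test k < n.
inOrbit : ∀ {n} → (Fin n → Fin n) → Fin n → Fin n → Bool
inOrbit {n} π x y = any (λ k → iter π k x == y) (upTo n)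

isRep : ∀ {n} → (Fin n → Fin n) → Fin n → Bool
isRep {n} π x = not (any (λ y → ⌊ y <? x ⌋ ∧ inOrbit π x y) (allFin n))

meets : ∀ {n} → (Fin n → Fin n) → Fin n → List (Fin n) → Bool
meets π x S = any (λ s → inOrbit π x s) S

count : ∀ {n} → (Fin n → Bool) → ℕ
count {zero}  P = 0
count {suc n} P = (if P zero then 1 else 0) + count (λ i → P (suc i))

-- z(π): number of π-orbits (fixed points included) = number of orbit representatives
z : ∀ {n} → (Fin n → Fin n) → ℕ
z π = count (isRep π)

orbitsMeeting : ∀ {n} → (Fin n → Fin n) → List (Fin n) → ℕ
orbitsMeeting π S = count (λ x → isRep π x ∧ meets π x S)

orbitsDisjoint : ∀ {n} → (Fin n → Fin n) → List (Fin n) → ℕ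
orbitsDisjoint π S = count (λ x → isRep π x ∧ not (meets π x S))

-- Reroute.  E = Fin n, E⊕ = Fin (suc n), with
--   a• = zero,  x ∈ E ∖ {a} ↦ suc x,  a∘ = suc a.
a• : ∀ {n} → Fin (suc n)
a• = zero

a∘ : ∀ {n} → Fin n → Fin (suc n)
a∘ a = suc a

-- σ∘⊕ : a by a∘ (i.e. y ↦ suc y), and a• inserted immediately before b
-- in the cycle of b:  σ∘⊕(a•) = b, σ∘⊕(x) = a• if σ∘(x) = b, else σ∘(x).
rerouteC : ∀ {n} → (Fin n → Fin n) → Fin n → Fin n → Fin (suc n) → Fin (suc n)
rerouteC σ a b zero    = suc b
rerouteC σ a b (suc x) = if σ x == b then zero else suc (σ x)

-- σ•⊕ : a replaced by a• everywhere in σ•, and a∘ a fixed point.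
renameB : ∀ {n} → Fin n → Fin n → Fin (suc n)
renameB a y = if y == a then zero else suc y

rerouteB : ∀ {n} → (Fin n → Fin n) → Fin n → Fin n → Fin (suc n) → Fin (suc n)
rerouteB σ a b zero    = renameB a (σ a)
rerouteB σ a b (suc x) = if x == a then suc a else renameB a (σ x)

-- Call a point y of E unaffected when y ≠ a, σ•(y) ≠ a and σ∘σ•(y) ≠ b.  At an
-- unaffected y the rerouted product takes the same step as σ∘σ•, and an orbit of
-- σ∘σ• avoids {a, σ∘(a), b} exactly when all of its points are unaffected (every
-- point of an orbit is the image of another one).  Such orbits therefore reappear
-- unchanged, with the same least element, as the orbits of σ∘⊕σ•⊕ avoiding
-- {a∘, a•, b}; conversely an orbit of σ∘⊕σ•⊕ through a point of E avoiding
-- {a∘, a•, b} can only have been built from unaffected steps.  Hence the orbits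
-- avoiding the distinguished points are counted by the same number U on both sides.
module Submission where

open import Defs
open import Data.Nat using (ℕ; _+_)
open import Data.Fin using (Fin)
open import Data.Fin.Permutation using (Permutation′; _⟨$⟩ʳ_)
open import Data.List using (_∷_; [])
open import Data.Product using (_×_)
open import Relation.Binary.PropositionalEquality using (_≡_; _≢_)

open import Data.Bool using (Bool; true; false; T; not; _∧_; _∨_; if_then_else_)
open import Data.Bool.ListAction using (any; or)
open import Data.Bool.Properties using (∧-zeroʳ; ¬-not; ⇔→≡)
open import Data.Fin using (zero; suc; toℕ; _≟_; _<?_)
open import Data.Fin.Properties using (pigeonhole; toℕ<n; suc-injective; 0≢1+n)
open import Data.List using (List; allFin)
open import Data.List.Membership.Propositional using (_∈_; _∉_; find)
open import Data.List.Properties using (map-tabulate; map-cong)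
open import Data.List.Relation.Unary.Any using (here; there)
import Data.List.Relation.Unary.Any as Any
open import Data.List.Relation.Unary.Any.Properties using (any⁺; any⁻; applyUpTo⁺; applyUpTo⁻)
open import Data.Nat using (suc; zero; _*_; _<_; _≤_; z<s; s<s; s<s⁻¹; NonZero)
open import Data.Nat.DivMod using (_%_; _/_; m≡m%n+[m/n]*n; m%n<n)
open import Data.Nat.Properties
  using ( ≤-refl; <⇒≤; <-≤-trans; ≤-pred; n<1+n; m<n⇒m<1+n; m<1+n⇒m<n∨m≡n
        ; +-suc; m≤n+m; m≤n⇒∃[o]m+o≡n)
open import Data.Product using (∃-syntax; _,_; proj₁; proj₂)
open import Data.Sum using (inj₁; inj₂)
open import Function using (_∘_; id)
open import Function.Bundles using (Injection; _⇔_; mk⇔; Equivalence)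
open import Function.Construct.Composition using (_⇔-∘_)
open import Function.Construct.Symmetry using (⇔-sym)
open import Function.Properties.Inverse using (↔⇒↣)
open import Relation.Nullary using (yes; no; contradiction)
open import Relation.Nullary.Decidable using (⌊_⌋; toWitness; fromWitness)
open import Relation.Binary.PropositionalEquality using (refl; sym; trans; cong; cong₂; subst; module ≡-Reasoning)

open ≡-Reasoning

T-⇔⇒≡ : ∀ {b c} → T b ⇔ T c → b ≡ c
T-⇔⇒≡ {false} {false} _ = refl
T-⇔⇒≡ {false} {true}  b⇔c = contradiction _ (Equivalence.from b⇔c)
T-⇔⇒≡ {true}  {false} b⇔c = contradiction _ (Equivalence.to b⇔c)
T-⇔⇒≡ {true}  {true}  _ = refl

==-false : ∀ {n} {x y : Fin n} → x ≢ y → (x == y) ≡ false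
==-false {x = x} {y} x≢y with x ≟ y
... | yes x≡y = contradiction x≡y x≢y
... | no _    = refl

==-true : ∀ {n} {x y : Fin n} → x ≡ y → (x == y) ≡ true
==-true {x = x} {y} x≡y with x ≟ y
... | yes _   = refl
... | no x≢y  = contradiction x≡y x≢y

<?-suc : ∀ {n} (i x : Fin n) → ⌊ suc i <? suc x ⌋ ≡ ⌊ i <? x ⌋
<?-suc i x with i <? x | suc i <? suc x
... | yes _   | yes _       = refl
... | no _    | no _        = refl
... | yes i<x | no 1+i≮1+x  = contradiction (s<s i<x) 1+i≮1+x
... | no i≮x  | yes 1+i<1+x = contradiction (s<s⁻¹ 1+i<1+x) i≮x

any-allFin-suc : ∀ {n} (p : Fin (suc n) → Bool) →
  any p (allFin (suc n)) ≡ p zero ∨ any (p ∘ suc) (allFin n)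
any-allFin-suc {n} p =
  cong (p zero ∨_) (cong or (trans (map-tabulate suc p) (sym (map-tabulate id (p ∘ suc)))))

perm-injective : ∀ {n} (σ : Permutation′ n) {x y : Fin n} → σ ⟨$⟩ʳ x ≡ σ ⟨$⟩ʳ y → x ≡ y
perm-injective σ = Injection.injective (↔⇒↣ σ)

count-cong : ∀ {n} {P Q : Fin n → Bool} → (∀ i → P i ≡ Q i) → count P ≡ count Q
count-cong {zero}  _   = refl
count-cong {suc n} P≗Q = cong₂ _+_ (cong (λ b → if b then 1 else 0) (P≗Q zero)) (count-cong (P≗Q ∘ suc))

count-split : ∀ {n} (P Q : Fin n → Bool) →
  count P ≡ count (λ x → P x ∧ not (Q x)) + count (λ x → P x ∧ Q x)
count-split {zero}  P Q = refl
count-split {suc n} P Q with P zero | Q zero | count-split (P ∘ suc) (Q ∘ suc)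
... | true  | true  | ih = trans (cong suc ih) (sym (+-suc _ _))
... | true  | false | ih = cong suc ih
... | false | true  | ih = ih
... | false | false | ih = ih

count-tail : ∀ {n} (P : Fin (suc n) → Bool) → P zero ≡ false → count P ≡ count (P ∘ suc)
count-tail P P0≡false rewrite P0≡false = refl

z-split : ∀ {n} (π : Fin n → Fin n) (S : List (Fin n)) →
  z π ≡ orbitsDisjoint π S + orbitsMeeting π S
z-split π S = count-split (isRep π) (λ x → meets π x S)

module _ {n} (π : Fin n → Fin n) where

  iter-+ : ∀ m k x → iter π (m + k) x ≡ iter π m (iter π k x)
  iter-+ zero    k x = refl
  iter-+ (suc m) k x = cong π (iter-+ m k x)

  iter-periodic : ∀ {p x} → iter π p x ≡ x → ∀ m → iter π (m * p) x ≡ x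
  iter-periodic _ zero = refl
  iter-periodic {p} {x} πᵖx≡x (suc m) = begin
    iter π (p + m * p) x        ≡⟨ iter-+ p (m * p) x ⟩
    iter π p (iter π (m * p) x) ≡⟨ cong (iter π p) (iter-periodic πᵖx≡x m) ⟩
    iter π p x                  ≡⟨ πᵖx≡x ⟩
    x                           ∎

  iter-mod : ∀ {p x} .{{_ : NonZero p}} → iter π p x ≡ x → ∀ k → iter π k x ≡ iter π (k % p) x
  iter-mod {p} {x} πᵖx≡x k = begin
    iter π k x                              ≡⟨ cong (λ m → iter π m x) (m≡m%n+[m/n]*n k p) ⟩
    iter π (k % p + (k / p) * p) x          ≡⟨ iter-+ (k % p) ((k / p) * p) x ⟩
    iter π (k % p) (iter π ((k / p) * p) x) ≡⟨ cong (iter π (k % p)) (iter-periodic πᵖx≡x (k / p)) ⟩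
    iter π (k % p) x                        ∎

  inOrbit⁺ : ∀ {x y k} → k < n → iter π k x ≡ y → T (inOrbit π x y)
  inOrbit⁺ k<n πᵏx≡y = any⁺ _ (applyUpTo⁺ id (fromWitness πᵏx≡y) k<n)

  inOrbit⁻ : ∀ {x y} → T (inOrbit π x y) → ∃[ k ] k < n × iter π k x ≡ y
  inOrbit⁻ t with k , k<n , πᵏx==y ← applyUpTo⁻ id (any⁻ _ _ t) = k , k<n , toWitness πᵏx==y

  Avoids : Fin n → List (Fin n) → Set
  Avoids x S = ∀ k → k < n → iter π k x ∉ S

  meets≡false⇔Avoids : ∀ {x S} → meets π x S ≡ false ⇔ Avoids x S
  meets≡false⇔Avoids {x} {S} = mk⇔ avoids disjoint
    where
    avoids : meets π x S ≡ false → Avoids x S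
    avoids meets≡false k k<n πᵏx∈S = subst T meets≡false (any⁺ _ (Any.map (inOrbit⁺ k<n) πᵏx∈S))

    disjoint : Avoids x S → meets π x S ≡ false
    disjoint avoid = ¬-not λ meets≡true →
      let s , s∈S , x↝s = find (any⁻ _ S (subst T (sym meets≡true) _))
          k , k<n , πᵏx≡s = inOrbit⁻ x↝s
      in avoid k k<n (subst (_∈ S) (sym πᵏx≡s) s∈S)

module _ {n} {π : Fin n → Fin n} (π-injective : ∀ {x y} → π x ≡ π y → x ≡ y) where

  iter-injective : ∀ k {x y} → iter π k x ≡ iter π k y → x ≡ y
  iter-injective zero    eq = eq
  iter-injective (suc k) eq = iter-injective k (π-injective eq)

  -- Pigeonhole on x, π x, …, πⁿ x, then cancel the common prefix by injectivity.
  iter-period : ∀ x → ∃[ p ] p < n × iter π (suc p) x ≡ x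
  iter-period x with i , j , i<j , πⁱx≡πʲx ← pigeonhole (n<1+n n) (λ i → iter π (toℕ i) x) =
    repeat⇒period (toℕ i) (m≤n⇒∃[o]m+o≡n i<j) (toℕ<n j) πⁱx≡πʲx
    where
    repeat⇒period : ∀ i {j} → ∃[ p ] suc i + p ≡ j → j < suc n → iter π i x ≡ iter π j x →
      ∃[ p ] p < n × iter π (suc p) x ≡ x
    repeat⇒period i (p , refl) j<1+n πⁱx≡πʲx =
      p , <-≤-trans (s<s (m≤n+m p i)) (≤-pred j<1+n) , iter-injective i (begin
        iter π i (iter π (suc p) x) ≡⟨ iter-+ π i (suc p) x ⟨
        iter π (i + suc p) x        ≡⟨ cong (λ m → iter π m x) (+-suc i p) ⟩
        iter π (suc i + p) x        ≡⟨ πⁱx≡πʲx ⟨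
        iter π i x                  ∎)

  iter-below : ∀ x k → ∃[ j ] j < n × iter π k x ≡ iter π j x
  iter-below x k with p , p<n , πᵖ⁺¹x≡x ← iter-period x =
    k % suc p , <-≤-trans (m%n<n k (suc p)) p<n , iter-mod π πᵖ⁺¹x≡x k

  iter-image : ∀ x k → ∃[ j ] iter π k x ≡ π (iter π j x)
  iter-image x k with p , _ , πᵖ⁺¹x≡x ← iter-period x = k + p , (begin
    iter π k x                  ≡⟨ cong (iter π k) πᵖ⁺¹x≡x ⟨
    iter π k (iter π (suc p) x) ≡⟨ iter-+ π k (suc p) x ⟨
    iter π (k + suc p) x        ≡⟨ cong (λ m → iter π m x) (+-suc k p) ⟩
    π (iter π (k + p) x)        ∎)

  iter-∀<n⇒∀ : ∀ (P : Fin n → Set) {x} → (∀ j → j < n → P (iter π j x)) → ∀ k → P (iter π k x)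
  iter-∀<n⇒∀ P below k with j , j<n , πᵏx≡πʲx ← iter-below _ k =
    subst P (sym πᵏx≡πʲx) (below j j<n)

module Reroute {n} (σ∘ σ• : Permutation′ n) (a b : Fin n) where

  π : Fin n → Fin n
  π x = σ∘ ⟨$⟩ʳ (σ• ⟨$⟩ʳ x)

  π⊕ : Fin (suc n) → Fin (suc n)
  π⊕ y = rerouteC (σ∘ ⟨$⟩ʳ_) a b (rerouteB (σ• ⟨$⟩ʳ_) a b y)

  S : List (Fin n)
  S = a ∷ (σ∘ ⟨$⟩ʳ a) ∷ b ∷ []

  S⊕ : List (Fin (suc n))
  S⊕ = a∘ a ∷ a• ∷ suc b ∷ []

  π-injective : ∀ {x y} → π x ≡ π y → x ≡ y
  π-injective = perm-injective σ• ∘ perm-injective σ∘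

  suc∈S⊕⇒∈S : ∀ {y} → suc y ∈ S⊕ → y ∈ S
  suc∈S⊕⇒∈S (here 1+y≡1+a)                  = here (suc-injective 1+y≡1+a)
  suc∈S⊕⇒∈S (there (there (here 1+y≡1+b))) = there (there (here (suc-injective 1+y≡1+b)))

  Unaffected : Fin n → Set
  Unaffected y = y ≢ a × σ• ⟨$⟩ʳ y ≢ a × π y ≢ b

  π⊕-unaffected : ∀ {y} → Unaffected y → π⊕ (suc y) ≡ suc (π y)
  π⊕-unaffected (y≢a , σ•y≢a , πy≢b)
    rewrite ==-false y≢a | ==-false σ•y≢a | ==-false πy≢b = refl

  π⊕-to-a• : ∀ {y} → y ≢ a → σ• ⟨$⟩ʳ y ≢ a → π y ≡ b → π⊕ (suc y) ≡ a•
  π⊕-to-a• y≢a σ•y≢a πy≡b rewrite ==-false y≢a | ==-false σ•y≢a | ==-true πy≡b = refl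

  π⊕-to-b : ∀ {y} → y ≢ a → σ• ⟨$⟩ʳ y ≡ a → π⊕ (suc y) ≡ suc b
  π⊕-to-b y≢a σ•y≡a rewrite ==-false y≢a | ==-true σ•y≡a = refl

  unaffected-by-step : ∀ {y} → y ≢ a → π⊕ (suc y) ≢ a• → π⊕ (suc y) ≢ suc b → Unaffected y
  unaffected-by-step {y} y≢a ≢a• ≢b = y≢a , σ•y≢a , πy≢b
    where
    σ•y≢a : σ• ⟨$⟩ʳ y ≢ a
    σ•y≢a σ•y≡a = ≢b (π⊕-to-b y≢a σ•y≡a)

    πy≢b : π y ≢ b
    πy≢b πy≡b = ≢a• (π⊕-to-a• y≢a σ•y≢a πy≡b)

  π⊕-tracks : ∀ {x} k → (∀ j → j < k → Unaffected (iter π j x)) →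
    iter π⊕ k (suc x) ≡ suc (iter π k x)
  π⊕-tracks zero    _          = refl
  π⊕-tracks (suc k) unaffected =
    trans (cong π⊕ (π⊕-tracks k (λ j j<k → unaffected j (m<n⇒m<1+n j<k))))
          (π⊕-unaffected (unaffected k (n<1+n k)))

  avoids⇒unaffected : ∀ {x} → (∀ k → iter π k x ∉ S) → ∀ k → Unaffected (iter π k x)
  avoids⇒unaffected avoid k =
      (λ πᵏx≡a → avoid k (here πᵏx≡a))
    , (λ σ•πᵏx≡a → avoid (suc k) (there (here (cong (σ∘ ⟨$⟩ʳ_) σ•πᵏx≡a))))
    , (λ πᵏ⁺¹x≡b → avoid (suc k) (there (there (here πᵏ⁺¹x≡b))))

  unaffected⇒avoids : ∀ {x} → (∀ k → Unaffected (iter π k x)) → ∀ k → iter π k x ∉ S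
  unaffected⇒avoids unaffected k (here πᵏx≡a) = proj₁ (unaffected k) πᵏx≡a
  unaffected⇒avoids unaffected k (there (here πᵏx≡σ∘a))
    with j , πᵏx≡πʲ⁺¹x ← iter-image π-injective _ k =
    proj₁ (proj₂ (unaffected j)) (perm-injective σ∘ (trans (sym πᵏx≡πʲ⁺¹x) πᵏx≡σ∘a))
  unaffected⇒avoids unaffected k (there (there (here πᵏx≡b)))
    with j , πᵏx≡πʲ⁺¹x ← iter-image π-injective _ k =
    proj₂ (proj₂ (unaffected j)) (trans (sym πᵏx≡πʲ⁺¹x) πᵏx≡b)

  Tracked : Fin n → Set
  Tracked x = ∀ k → iter π⊕ k (suc x) ≡ suc (iter π k x)

  avoids⇒tracked : ∀ {x} → Avoids π x S → Tracked x
  avoids⇒tracked avoid k =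
    π⊕-tracks k (λ j _ → avoids⇒unaffected (iter-∀<n⇒∀ π-injective (_∉ S) avoid) j)

  -- Induction along the π⊕-orbit: as long as it has been tracking the π-orbit, the
  -- next step avoids a• and suc b, so the current point is unaffected.
  unaffected-prefix : ∀ {x} → Avoids π⊕ (suc x) S⊕ →
    ∀ k → k ≤ n → ∀ j → j < k → Unaffected (iter π j x)
  unaffected-prefix _ zero _ _ ()
  unaffected-prefix {x} avoid⊕ (suc k) k<n j j<1+k with m<1+n⇒m<n∨m≡n j<1+k
  ... | inj₁ j<k  = unaffected-prefix avoid⊕ k (<⇒≤ k<n) j j<k
  ... | inj₂ refl = unaffected-by-step
      (λ πᵏx≡a → avoid⊕ k (m<n⇒m<1+n k<n) (here (trans tracked (cong suc πᵏx≡a))))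
      (λ step≡a• → avoid⊕ (suc k) (s<s k<n) (there (here (trans (cong π⊕ tracked) step≡a•))))
      (λ step≡b → avoid⊕ (suc k) (s<s k<n) (there (there (here (trans (cong π⊕ tracked) step≡b)))))
    where
    tracked : iter π⊕ k (suc x) ≡ suc (iter π k x)
    tracked = π⊕-tracks k (unaffected-prefix avoid⊕ k (<⇒≤ k<n))

  avoids-reroute : ∀ {x} → Avoids π⊕ (suc x) S⊕ ⇔ Avoids π x S
  avoids-reroute {x} = mk⇔ to from
    where
    to : Avoids π⊕ (suc x) S⊕ → Avoids π x S
    to avoid⊕ k _ = unaffected⇒avoids
      (iter-∀<n⇒∀ π-injective Unaffected (unaffected-prefix avoid⊕ n ≤-refl)) k

    from : Avoids π x S → Avoids π⊕ (suc x) S⊕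
    from avoid k k<1+n πᵏx∈S⊕ = iter-∀<n⇒∀ π-injective (_∉ S) avoid k
      (suc∈S⊕⇒∈S (subst (_∈ S⊕) (avoids⇒tracked avoid k) πᵏx∈S⊕))

  meets-reroute : ∀ x → meets π⊕ (suc x) S⊕ ≡ meets π x S
  meets-reroute x =
    ⇔→≡ (⇔-sym (meets≡false⇔Avoids π) ⇔-∘ (avoids-reroute ⇔-∘ meets≡false⇔Avoids π⊕))

  isRep-reroute : ∀ {x} → Tracked x → isRep π⊕ (suc x) ≡ isRep π x
  isRep-reroute {x} tracked = cong not (begin
    any before⊕ (allFin (suc n))
      ≡⟨ any-allFin-suc before⊕ ⟩
    before⊕ a• ∨ any (before⊕ ∘ suc) (allFin n)
      ≡⟨ cong₂ _∨_ before⊕-a• (cong or (map-cong before⊕-suc (allFin n))) ⟩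
    any before (allFin n)
      ∎)
    where
    before⊕ : Fin (suc n) → Bool
    before⊕ y = ⌊ y <? suc x ⌋ ∧ inOrbit π⊕ (suc x) y

    before : Fin n → Bool
    before y = ⌊ y <? x ⌋ ∧ inOrbit π x y

    inOrbit⊕-a• : inOrbit π⊕ (suc x) a• ≡ false
    inOrbit⊕-a• = ¬-not λ x↝a• →
      let k , _ , π⊕ᵏx≡a• = inOrbit⁻ π⊕ {suc x} {a•} (subst T (sym x↝a•) _)
      in 0≢1+n (trans (sym π⊕ᵏx≡a•) (tracked k))

    inOrbit⊕-suc : ∀ y → inOrbit π⊕ (suc x) (suc y) ≡ inOrbit π x y
    inOrbit⊕-suc y = T-⇔⇒≡ (mk⇔
      (λ x↝y → let k , _ , π⊕ᵏx≡y = inOrbit⁻ π⊕ x↝y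
                   j , j<n , πᵏx≡πʲx = iter-below π-injective x k
               in inOrbit⁺ π j<n
                    (trans (sym πᵏx≡πʲx) (suc-injective (trans (sym (tracked k)) π⊕ᵏx≡y))))
      (λ x↝y → let k , k<n , πᵏx≡y = inOrbit⁻ π x↝y
               in inOrbit⁺ π⊕ (m<n⇒m<1+n k<n) (trans (tracked k) (cong suc πᵏx≡y))))

    before⊕-a• : before⊕ a• ≡ false
    before⊕-a• = trans (cong (⌊ a• {n} <? suc x ⌋ ∧_) inOrbit⊕-a•) (∧-zeroʳ ⌊ a• {n} <? suc x ⌋)

    before⊕-suc : ∀ y → before⊕ (suc y) ≡ before y
    before⊕-suc y = cong₂ _∧_ (<?-suc y x) (inOrbit⊕-suc y)

  disjoint-reroute : ∀ x →
    (isRep π⊕ (suc x) ∧ not (meets π⊕ (suc x) S⊕)) ≡ (isRep π x ∧ not (meets π x S))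
  disjoint-reroute x rewrite meets-reroute x with meets π x S in meets≡
  ... | true  = trans (∧-zeroʳ _) (sym (∧-zeroʳ _))
  ... | false =
    cong (_∧ true) (isRep-reroute (avoids⇒tracked (Equivalence.to (meets≡false⇔Avoids π {x} {S}) meets≡)))

  meets-a• : meets π⊕ a• S⊕ ≡ true
  meets-a• = ¬-not λ meets≡false →
    Equivalence.to (meets≡false⇔Avoids π⊕ {a•} {S⊕}) meets≡false 0 z<s (there (here refl))

  orbitsDisjoint-reroute : orbitsDisjoint π⊕ S⊕ ≡ orbitsDisjoint π S
  orbitsDisjoint-reroute = trans (count-tail disjoint⊕ a•-not-disjoint) (count-cong disjoint-reroute)
    where
    disjoint⊕ : Fin (suc n) → Bool
    disjoint⊕ y = isRep π⊕ y ∧ not (meets π⊕ y S⊕)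

    a•-not-disjoint : disjoint⊕ a• ≡ false
    a•-not-disjoint = trans (cong (λ m → isRep π⊕ a• ∧ not m) meets-a•) (∧-zeroʳ _)

mainTheorem18 : (n : ℕ) (σ∘ σ• : Permutation′ n) (a b : Fin n) → a ≢ b →
    let π  = λ x → σ∘ ⟨$⟩ʳ (σ• ⟨$⟩ʳ x)
        π⊕ = λ y → rerouteC (σ∘ ⟨$⟩ʳ_) a b (rerouteB (σ• ⟨$⟩ʳ_) a b y)
        U  = orbitsDisjoint π (a ∷ (σ∘ ⟨$⟩ʳ a) ∷ b ∷ [])
        B  = orbitsMeeting π (a ∷ (σ∘ ⟨$⟩ʳ a) ∷ b ∷ [])
        B⊕ = orbitsMeeting π⊕ (a∘ a ∷ a• ∷ Fin.suc b ∷ [])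
    in (z π ≡ U + B) × (z π⊕ ≡ U + B⊕)
mainTheorem18 n σ∘ σ• a b _ = z-split π S , (begin
    z π⊕                                        ≡⟨ z-split π⊕ S⊕ ⟩
    orbitsDisjoint π⊕ S⊕ + orbitsMeeting π⊕ S⊕ ≡⟨ cong (_+ orbitsMeeting π⊕ S⊕) orbitsDisjoint-reroute ⟩
    orbitsDisjoint π S + orbitsMeeting π⊕ S⊕   ∎)
  where open Reroute σ∘ σ• a b
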